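{- Let $n\ge 1$ and $k\ge 0$ be integers, let $m\in\{0,1\}$, and put $r=n+k+m$ and $s=n-k+m$. Let $a(r,s)$ denote the coefficient of $x^s$ in the Chebyshev polynomial of degree $r$, of the second kind $U_r$ if $m=0$ and of the first kind $T_r$ if $m=1$ (with coefficient $0$ if $s<0$). Then $$(-1)^k a(r,s)=\sum_{i=0}^{n}(-1)^i\binom{n}{i}\binom{2n+m-2i}{n+k}.$$
   Context: The Chebyshev polynomials of the first kind are $T_0=1$, $T_1=x$, $T_{r+1}=2xT_r-T_{r-1}$; those of the second kind are $U_0=1$, $U_1=2x$, $U_{r+1}=2xU_r-U_{r-1}$. -}

module Defs where

open import Data.Nat as ℕ using (ℕ; zero; suc)
open import Data.Nat.Combinatorics using (_C_)
open import Data.Integer as ℤ using (ℤ; +_; -[1+_]; _+_; _*_; -_; _-_)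

-- A polynomial over ℤ is represented by its coefficient function:
-- P j is the coefficient of x^j.
Poly : Set
Poly = ℕ → ℤ

mulX : Poly → Poly
mulX P zero    = + 0
mulX P (suc j) = P j

one : Poly
one zero    = + 1
one (suc j) = + 0

xPoly : Poly
xPoly = mulX one

step : Poly → Poly → Poly
step P Q j = (+ 2) * mulX P j - Q j

T : ℕ → Poly
T zero = one
T (suc zero) = xPoly
T (suc (suc r)) = step (T (suc r)) (T r)

U : ℕ → Poly
U zero = one
U (suc zero) = λ j → (+ 2) * xPoly j
U (suc (suc r)) = step (U (suc r)) (U r)

coeffℤ : Poly → ℤ → ℤ
coeffℤ P (+ s)      = P s
coeffℤ P -[1+ _ ]   = + 0

cheb : ℕ → ℕ → Poly
cheb zero    r = U r
cheb (suc _) r = T r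

a : ℕ → ℕ → ℤ → ℤ
a m r s = coeffℤ (cheb m r) s

sgn : ℕ → ℤ
sgn zero = + 1
sgn (suc i) = - sgn i

sumTo : ℕ → (ℕ → ℤ) → ℤ
sumTo zero    f = f 0
sumTo (suc n) f = sumTo n f + f (suc n)

module Submission where

-- Both sides of the identity are functions Λ(n,k) and R(n,k) of (n,k) ∈ ℕ²
-- (m fixed) satisfying the same two-dimensional recurrence
--   A(n+1,k+1) = 2·A(n,k+1) + A(n,k),
-- so it suffices that they agree on the axes n = 0 and k = 0
-- ('recurrence-unique').
--
-- * Right side: R(n,k) = H(n,m,n+k) for the alternating binomial sum
--   H(n,q,c) = Σ_{i≤n} (-1)^i C(n,i) C(2n+q-2i, c).  Pascal's rule in each of
--   the two binomials gives H(n+1,q,c+1) = H(n,q,c) + H(n,q+1,c), from which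
--   both the recurrence and the diagonal value H(n,q,n) = 2^n follow.
-- * Left side: Λ(n,k) = (-1)^k [x^{n-k+m}] F_{n+k+m}; the recurrence is
--   F_{r+2} = 2x F_{r+1} − F_r read off at one coefficient, and the axis k = 0
--   is the leading coefficient, computed from a degree bound.
-- * On the axis n = 0 the exponent m-k is ≤ 0 for k ≥ 2, leaving only the
--   constant coefficients of U_0, T_1 and T_2, checked directly.
-- The identity holds for all n ≥ 0.

open import Defs
open import Data.Nat as ℕ using (ℕ; _≤_; _∸_; _^_; zero; suc; z≤n; s≤s)
open import Data.Nat.Combinatorics using (_C_; nCk+nC[k+1]≡[n+1]C[k+1])
open import Data.Nat.Combinatorics.Specification using (k>n⇒nCk≡0)
open import Data.Integer as ℤ using (ℤ; +_; _*_; _-_; -_)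
open import Relation.Binary.PropositionalEquality
import Data.Nat.Properties as ℕP
import Data.Integer.Properties as ℤP
open import Data.Integer.Tactic.RingSolver using (solve-∀)

open ≡-Reasoning

sumTo-cong : ∀ n {f g : ℕ → ℤ} → (∀ i → i ≤ n → f i ≡ g i) → sumTo n f ≡ sumTo n g
sumTo-cong zero    f≗g = f≗g 0 z≤n
sumTo-cong (suc n) f≗g =
  cong₂ ℤ._+_ (sumTo-cong n (λ i i≤n → f≗g i (ℕP.m≤n⇒m≤1+n i≤n))) (f≗g (suc n) ℕP.≤-refl)

sumTo-+ : ∀ n (f g : ℕ → ℤ) → sumTo n (λ i → f i ℤ.+ g i) ≡ sumTo n f ℤ.+ sumTo n g
sumTo-+ zero    f g = refl
sumTo-+ (suc n) f g = begin
    sumTo n (λ i → f i ℤ.+ g i) ℤ.+ (f (suc n) ℤ.+ g (suc n))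
  ≡⟨ cong (ℤ._+ (f (suc n) ℤ.+ g (suc n))) (sumTo-+ n f g) ⟩
    sumTo n f ℤ.+ sumTo n g ℤ.+ (f (suc n) ℤ.+ g (suc n))
  ≡⟨ interchange (sumTo n f) (sumTo n g) (f (suc n)) (g (suc n)) ⟩
    sumTo n f ℤ.+ f (suc n) ℤ.+ (sumTo n g ℤ.+ g (suc n))
  ∎
  where
  interchange : ∀ a b c d → a ℤ.+ b ℤ.+ (c ℤ.+ d) ≡ a ℤ.+ c ℤ.+ (b ℤ.+ d)
  interchange = solve-∀

sumTo-- : ∀ n (f g : ℕ → ℤ) → sumTo n (λ i → f i - g i) ≡ sumTo n f - sumTo n g
sumTo-- zero    f g = refl
sumTo-- (suc n) f g = begin
    sumTo n (λ i → f i - g i) ℤ.+ (f (suc n) - g (suc n))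
  ≡⟨ cong (ℤ._+ (f (suc n) - g (suc n))) (sumTo-- n f g) ⟩
    sumTo n f - sumTo n g ℤ.+ (f (suc n) - g (suc n))
  ≡⟨ interchange (sumTo n f) (sumTo n g) (f (suc n)) (g (suc n)) ⟩
    sumTo n f ℤ.+ f (suc n) - (sumTo n g ℤ.+ g (suc n))
  ∎
  where
  interchange : ∀ a b c d → a - b ℤ.+ (c - d) ≡ a ℤ.+ c - (b ℤ.+ d)
  interchange = solve-∀

sumTo-shift : ∀ n (f : ℕ → ℤ) → sumTo (suc n) f ≡ f 0 ℤ.+ sumTo n (λ j → f (suc j))
sumTo-shift zero    f = refl
sumTo-shift (suc n) f = begin
    sumTo (suc n) f ℤ.+ f (suc (suc n))
  ≡⟨ cong (ℤ._+ f (suc (suc n))) (sumTo-shift n f) ⟩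
    f 0 ℤ.+ sumTo n (λ j → f (suc j)) ℤ.+ f (suc (suc n))
  ≡⟨ ℤP.+-assoc (f 0) _ _ ⟩
    f 0 ℤ.+ sumTo (suc n) (λ j → f (suc j))
  ∎

top : ℕ → ℕ → ℕ → ℕ
top n q i = 2 ℕ.* n ℕ.+ q ∸ 2 ℕ.* i

term : ℕ → ℕ → ℕ → ℕ → ℤ
term n q c i = sgn i * + (n C i) * + (top n q i C c)

H : ℕ → ℕ → ℕ → ℤ
H n q c = sumTo n (term n q c)

double-suc : ∀ n → 2 ℕ.* suc n ≡ suc (suc (2 ℕ.* n))
double-suc n = ℕP.*-suc 2 n

top-suc-suc : ∀ n q i → top (suc n) q (suc i) ≡ top n q i
top-suc-suc n q i = cong₂ (λ a b → a ℕ.+ q ∸ b) (double-suc n) (double-suc i)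

top-suc-zero : ∀ n q → top (suc n) q 0 ≡ top n (suc (suc q)) 0
top-suc-zero n q = begin
    2 ℕ.* suc n ℕ.+ q          ≡⟨ cong (ℕ._+ q) (double-suc n) ⟩
    suc (suc (2 ℕ.* n ℕ.+ q))  ≡⟨ cong suc (ℕP.+-suc (2 ℕ.* n) q) ⟨
    suc (2 ℕ.* n ℕ.+ suc q)    ≡⟨ ℕP.+-suc (2 ℕ.* n) (suc q) ⟨
    2 ℕ.* n ℕ.+ suc (suc q)    ∎

top-shift : ∀ n q j → top n (suc (suc q)) (suc j) ≡ top n q j
top-shift n q j = begin
    top n (suc (suc q)) (suc j)  ≡⟨ cong (_∸ 2 ℕ.* suc j) (top-suc-zero n q) ⟨
    top (suc n) q (suc j)        ≡⟨ top-suc-suc n q j ⟩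
    top n q j                    ∎

top-suc-q : ∀ n q i → i ≤ n → top n (suc q) i ≡ suc (top n q i)
top-suc-q n q i i≤n = begin
    2 ℕ.* n ℕ.+ suc q ∸ 2 ℕ.* i
  ≡⟨ cong (_∸ 2 ℕ.* i) (trans (ℕP.+-suc (2 ℕ.* n) q) (ℕP.+-comm 1 _)) ⟩
    2 ℕ.* n ℕ.+ q ℕ.+ 1 ∸ 2 ℕ.* i
  ≡⟨ ℕP.+-∸-comm 1 2i≤2n+q ⟩
    top n q i ℕ.+ 1
  ≡⟨ ℕP.+-comm _ 1 ⟩
    suc (top n q i)
  ∎
  where
  2i≤2n+q : 2 ℕ.* i ≤ 2 ℕ.* n ℕ.+ q
  2i≤2n+q = ℕP.≤-trans (ℕP.*-monoʳ-≤ 2 i≤n) (ℕP.m≤m+n (2 ℕ.* n) q)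

-- Pascal's rule in C(n,i): the term with i = j+1 of H(n+1,q,c) splits into a
-- term of H(n,q+2,c) minus a term of H(n,q,c).
term-pascal-n : ∀ n q c j →
  term (suc n) q c (suc j) ≡ term n (suc (suc q)) c (suc j) - term n q c j
term-pascal-n n q c j = begin
    (- sgn j) * + (suc n C suc j) * + (top (suc n) q (suc j) C c)
  ≡⟨ cong₂ (λ a t → (- sgn j) * + a * + (t C c))
       (sym (nCk+nC[k+1]≡[n+1]C[k+1] n j)) (top-suc-suc n q j) ⟩
    (- sgn j) * (+ (n C j) ℤ.+ + (n C suc j)) * + (top n q j C c)
  ≡⟨ expand (sgn j) (+ (n C j)) (+ (n C suc j)) (+ (top n q j C c)) ⟩
    (- sgn j) * + (n C suc j) * + (top n q j C c) - term n q c j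
  ≡⟨ cong (λ t → (- sgn j) * + (n C suc j) * + (t C c) - term n q c j) (top-shift n q j) ⟨
    term n (suc (suc q)) c (suc j) - term n q c j
  ∎
  where
  expand : ∀ s a b x → (- s) * (a ℤ.+ b) * x ≡ (- s) * b * x - s * a * x
  expand = solve-∀

H-pascal-n : ∀ n q c → H (suc n) q c ≡ H n (suc (suc q)) c - H n q c
H-pascal-n n q c = begin
    H (suc n) q c
  ≡⟨ sumTo-shift n (term (suc n) q c) ⟩
    term (suc n) q c 0 ℤ.+ sumTo n (λ j → term (suc n) q c (suc j))
  ≡⟨ cong₂ ℤ._+_ (cong (λ t → + 1 * + 1 * + (t C c)) (top-suc-zero n q))
       (sumTo-cong n (λ j _ → term-pascal-n n q c j)) ⟩
    term n q′ c 0 ℤ.+ sumTo n (λ j → term n q′ c (suc j) - term n q c j)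
  ≡⟨ cong (λ t → term n q′ c 0 ℤ.+ t) (sumTo-- n (λ j → term n q′ c (suc j)) (term n q c)) ⟩
    term n q′ c 0 ℤ.+ (sumTo n (λ j → term n q′ c (suc j)) - H n q c)
  ≡⟨ ℤP.+-assoc (term n q′ c 0) _ _ ⟨
    term n q′ c 0 ℤ.+ sumTo n (λ j → term n q′ c (suc j)) - H n q c
  ≡⟨ cong (_- H n q c) (sumTo-shift n (term n q′ c)) ⟨
    H n q′ c ℤ.+ term n q′ c (suc n) - H n q c
  ≡⟨ cong (λ t → H n q′ c ℤ.+ t - H n q c) last-term-vanishes ⟩
    H n q′ c ℤ.+ + 0 - H n q c
  ≡⟨ cong (_- H n q c) (ℤP.+-identityʳ (H n q′ c)) ⟩
    H n q′ c - H n q c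
  ∎
  where
  q′ : ℕ
  q′ = suc (suc q)
  last-term-vanishes : term n q′ c (suc n) ≡ + 0
  last-term-vanishes = begin
      sgn (suc n) * + (n C suc n) * X  ≡⟨ cong (λ a → sgn (suc n) * + a * X) (k>n⇒nCk≡0 {n} {suc n} ℕP.≤-refl) ⟩
      sgn (suc n) * + 0 * X            ≡⟨ cong (_* X) (ℤP.*-zeroʳ (sgn (suc n))) ⟩
      + 0 * X                          ≡⟨ ℤP.*-zeroˡ X ⟩
      + 0                              ∎
    where
    X : ℤ
    X = + (top n q′ (suc n) C c)

-- Pascal's rule in C(2n+q-2i, c): raising q by one splits each term.
term-pascal-top : ∀ n q c i → i ≤ n →
  term n (suc q) (suc c) i ≡ term n q (suc c) i ℤ.+ term n q c i
term-pascal-top n q c i i≤n = begin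
    s * + (top n (suc q) i C suc c)
  ≡⟨ cong (λ t → s * + (t C suc c)) (top-suc-q n q i i≤n) ⟩
    s * + (suc (top n q i) C suc c)
  ≡⟨ cong (λ t → s * + t) (nCk+nC[k+1]≡[n+1]C[k+1] (top n q i) c) ⟨
    s * (+ (top n q i C c) ℤ.+ + (top n q i C suc c))
  ≡⟨ ℤP.*-distribˡ-+ s (+ (top n q i C c)) _ ⟩
    s * + (top n q i C c) ℤ.+ s * + (top n q i C suc c)
  ≡⟨ ℤP.+-comm (s * + (top n q i C c)) _ ⟩
    term n q (suc c) i ℤ.+ term n q c i
  ∎
  where
  s : ℤ
  s = sgn i * + (n C i)

H-pascal-top : ∀ n q c → H n (suc q) (suc c) ≡ H n q (suc c) ℤ.+ H n q c
H-pascal-top n q c =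
  trans (sumTo-cong n (term-pascal-top n q c)) (sumTo-+ n (term n q (suc c)) (term n q c))

H-step : ∀ n q c → H (suc n) q (suc c) ≡ H n q c ℤ.+ H n (suc q) c
H-step n q c = begin
    H (suc n) q (suc c)
  ≡⟨ H-pascal-n n q (suc c) ⟩
    H n (suc (suc q)) (suc c) - H n q (suc c)
  ≡⟨ cong (_- H n q (suc c)) (H-pascal-top n (suc q) c) ⟩
    H n (suc q) (suc c) ℤ.+ H n (suc q) c - H n q (suc c)
  ≡⟨ cong (λ t → t ℤ.+ H n (suc q) c - H n q (suc c)) (H-pascal-top n q c) ⟩
    H n q (suc c) ℤ.+ H n q c ℤ.+ H n (suc q) c - H n q (suc c)
  ≡⟨ cancel (H n q (suc c)) (H n q c) (H n (suc q) c) ⟩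
    H n q c ℤ.+ H n (suc q) c
  ∎
  where
  cancel : ∀ a b d → a ℤ.+ b ℤ.+ d - a ≡ b ℤ.+ d
  cancel = solve-∀

H-diag : ∀ n q → H n q n ≡ + (2 ^ n)
H-diag zero    q = refl
H-diag (suc n) q = begin
    H (suc n) q (suc n)             ≡⟨ H-step n q n ⟩
    H n q n ℤ.+ H n (suc q) n       ≡⟨ cong₂ ℤ._+_ (H-diag n q) (H-diag n (suc q)) ⟩
    + (2 ^ n ℕ.+ 2 ^ n)             ≡⟨ cong (λ t → + (2 ^ n ℕ.+ t)) (ℕP.+-identityʳ (2 ^ n)) ⟨
    + (2 ^ suc n)                   ∎

-- The two-dimensional recurrence, in the form shared with the Chebyshev side.
H-rec : ∀ n q c → H (suc n) q (suc (suc c)) ≡ + 2 * H n q (suc c) ℤ.+ H n q c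
H-rec n q c = begin
    H (suc n) q (suc (suc c))               ≡⟨ H-step n q (suc c) ⟩
    H n q (suc c) ℤ.+ H n (suc q) (suc c)   ≡⟨ cong (λ t → H n q (suc c) ℤ.+ t) (H-pascal-top n q c) ⟩
    H n q (suc c) ℤ.+ (H n q (suc c) ℤ.+ H n q c)
                                            ≡⟨ regroup (H n q (suc c)) (H n q c) ⟩
    + 2 * H n q (suc c) ℤ.+ H n q c         ∎
  where
  regroup : ∀ a b → a ℤ.+ (a ℤ.+ b) ≡ + 2 * a ℤ.+ b
  regroup = solve-∀

DoublingRecurrence : (ℕ → ℕ → ℤ) → Set
DoublingRecurrence A = ∀ n k → A (suc n) (suc k) ≡ + 2 * A n (suc k) ℤ.+ A n k

recurrence-unique : ∀ {A B : ℕ → ℕ → ℤ} →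
  DoublingRecurrence A → DoublingRecurrence B →
  (∀ k → A 0 k ≡ B 0 k) → (∀ n → A n 0 ≡ B n 0) → ∀ n k → A n k ≡ B n k
recurrence-unique recA recB axis₀ axis₁ zero    k       = axis₀ k
recurrence-unique recA recB axis₀ axis₁ (suc n) zero    = axis₁ (suc n)
recurrence-unique {A} {B} recA recB axis₀ axis₁ (suc n) (suc k) = begin
    A (suc n) (suc k)                ≡⟨ recA n k ⟩
    + 2 * A n (suc k) ℤ.+ A n k      ≡⟨ cong₂ (λ x y → + 2 * x ℤ.+ y) (agree n (suc k)) (agree n k) ⟩
    + 2 * B n (suc k) ℤ.+ B n k      ≡⟨ recB n k ⟨
    B (suc n) (suc k)                ∎
  where
  agree : ∀ n k → A n k ≡ B n k
  agree = recurrence-unique {A} {B} recA recB axis₀ axis₁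

R : ℕ → ℕ → ℕ → ℤ
R m n k = H n m (n ℕ.+ k)

R-rec : ∀ m → DoublingRecurrence (R m)
R-rec m n k = begin
    H (suc n) m (suc (n ℕ.+ suc k))              ≡⟨ cong (λ t → H (suc n) m (suc t)) (ℕP.+-suc n k) ⟩
    H (suc n) m (suc (suc (n ℕ.+ k)))            ≡⟨ H-rec n m (n ℕ.+ k) ⟩
    + 2 * H n m (suc (n ℕ.+ k)) ℤ.+ R m n k      ≡⟨ cong (λ t → + 2 * H n m t ℤ.+ R m n k) (ℕP.+-suc n k) ⟨
    + 2 * R m n (suc k) ℤ.+ R m n k              ∎

ChebyshevRecurrence : (ℕ → Poly) → Set
ChebyshevRecurrence F = ∀ r j → F (suc (suc r)) j ≡ step (F (suc r)) (F r) j

cheb-rec : ∀ m → ChebyshevRecurrence (cheb m)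
cheb-rec zero    r j = refl
cheb-rec (suc _) r j = refl

DegreeAtMost : ℕ → Poly → Set
DegreeAtMost d P = ∀ j → P (suc (d ℕ.+ j)) ≡ + 0

coeff-step : ∀ P Q z → coeffℤ (step P Q) z ≡ + 2 * coeffℤ P (z - + 1) - coeffℤ Q z
coeff-step P Q (+ zero)  = refl
coeff-step P Q (+ suc j) = refl
coeff-step P Q ℤ.-[1+ t ] = refl

module ChebyshevFamily {F : ℕ → Poly} (rec : ChebyshevRecurrence F) where

  degree-bound : DegreeAtMost 0 (F 0) → DegreeAtMost 1 (F 1) → ∀ r → DegreeAtMost r (F r)
  degree-bound deg₀ deg₁ zero          = deg₀
  degree-bound deg₀ deg₁ (suc zero)    = deg₁
  degree-bound deg₀ deg₁ (suc (suc r)) j = begin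
      F (suc (suc r)) (suc (suc (suc (r ℕ.+ j))))
    ≡⟨ rec r _ ⟩
      + 2 * F (suc r) (suc (suc (r ℕ.+ j))) - F r (suc (suc (suc (r ℕ.+ j))))
    ≡⟨ cong₂ (λ x y → + 2 * x - y) (degree-bound deg₀ deg₁ (suc r) j)
         (trans (cong (F r) (cong suc (+-suc₂ r j))) (degree-bound deg₀ deg₁ r (suc (suc j)))) ⟩
      + 0
    ∎
    where
    +-suc₂ : ∀ r j → suc (suc (r ℕ.+ j)) ≡ r ℕ.+ suc (suc j)
    +-suc₂ r j = sym (trans (ℕP.+-suc r (suc j)) (cong suc (ℕP.+-suc r j)))

  leading-doubles : (∀ r → DegreeAtMost r (F r)) →
    ∀ r → F (suc (suc r)) (suc (suc r)) ≡ + 2 * F (suc r) (suc r)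
  leading-doubles deg r = begin
      F (suc (suc r)) (suc (suc r))                      ≡⟨ rec r _ ⟩
      + 2 * F (suc r) (suc r) - F r (suc (suc r))        ≡⟨ cong (λ y → + 2 * F (suc r) (suc r) - y) above-degree ⟩
      + 2 * F (suc r) (suc r) ℤ.+ + 0                    ≡⟨ ℤP.+-identityʳ _ ⟩
      + 2 * F (suc r) (suc r)                            ∎
    where
    above-degree : F r (suc (suc r)) ≡ + 0
    above-degree = trans (cong (λ t → F r (suc t)) (ℕP.+-comm 1 r)) (deg r 1)

  Λ : ℕ → ℕ → ℕ → ℤ
  Λ m n k = sgn k * coeffℤ (F (n ℕ.+ k ℕ.+ m)) ((+ n) - (+ k) ℤ.+ (+ m))

  -- Reading F_{r+2} = 2x F_{r+1} − F_r at x^{n-k+m}, with r = n+k+m.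
  Λ-rec : ∀ m → DoublingRecurrence (Λ m)
  Λ-rec m n k = begin
      Λ m (suc n) (suc k)
    ≡⟨ cong₂ (λ r w → (- sgn k) * coeffℤ (F r) w) (cong (λ t → suc t ℕ.+ m) (ℕP.+-suc n k))
         (shift-both (+ n) (+ k) (+ m)) ⟩
      (- sgn k) * coeffℤ (F (suc (suc r))) z
    ≡⟨ cong ((- sgn k) *_) (coeff-cong (rec r) z) ⟩
      (- sgn k) * coeffℤ (step (F (suc r)) (F r)) z
    ≡⟨ cong ((- sgn k) *_) (coeff-step (F (suc r)) (F r) z) ⟩
      (- sgn k) * (+ 2 * coeffℤ (F (suc r)) (z - + 1) - coeffℤ (F r) z)
    ≡⟨ distribute (sgn k) _ _ ⟩
      + 2 * ((- sgn k) * coeffℤ (F (suc r)) (z - + 1)) ℤ.+ Λ m n k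
    ≡⟨ cong₂ (λ r w → + 2 * ((- sgn k) * coeffℤ (F r) w) ℤ.+ Λ m n k)
         (cong (ℕ._+ m) (ℕP.+-suc n k)) (shift-k (+ n) (+ k) (+ m)) ⟨
      + 2 * Λ m n (suc k) ℤ.+ Λ m n k
    ∎
    where
    r : ℕ
    r = n ℕ.+ k ℕ.+ m
    z : ℤ
    z = (+ n) - (+ k) ℤ.+ (+ m)
    coeff-cong : ∀ {P Q : Poly} → (∀ j → P j ≡ Q j) → ∀ w → coeffℤ P w ≡ coeffℤ Q w
    coeff-cong P≗Q (+ j)       = P≗Q j
    coeff-cong P≗Q ℤ.-[1+ _ ] = refl
    shift-both : ∀ a b c → (+ 1 ℤ.+ a) - (+ 1 ℤ.+ b) ℤ.+ c ≡ a - b ℤ.+ c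
    shift-both = solve-∀
    shift-k : ∀ a b c → a - (+ 1 ℤ.+ b) ℤ.+ c ≡ a - b ℤ.+ c - + 1
    shift-k = solve-∀
    distribute : ∀ s x y → (- s) * (+ 2 * x - y) ≡ + 2 * ((- s) * x) ℤ.+ s * y
    distribute = solve-∀

module U-Family = ChebyshevFamily (cheb-rec 0)
module T-Family = ChebyshevFamily (cheb-rec 1)

U-degree : ∀ r → DegreeAtMost r (U r)
U-degree = U-Family.degree-bound (λ _ → refl) (λ _ → refl)

T-degree : ∀ r → DegreeAtMost r (T r)
T-degree = T-Family.degree-bound (λ _ → refl) (λ _ → refl)

U-leading : ∀ r → U r r ≡ + (2 ^ r)
U-leading zero          = refl
U-leading (suc zero)    = refl
U-leading (suc (suc r)) = begin
    U (suc (suc r)) (suc (suc r))  ≡⟨ U-Family.leading-doubles U-degree r ⟩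
    + 2 * U (suc r) (suc r)        ≡⟨ cong (+ 2 *_) (U-leading (suc r)) ⟩
    + 2 * + (2 ^ suc r)            ≡⟨ ℤP.pos-* 2 (2 ^ suc r) ⟨
    + (2 ^ suc (suc r))            ∎

T-leading : ∀ r → T (suc r) (suc r) ≡ + (2 ^ r)
T-leading zero    = refl
T-leading (suc r) = begin
    T (suc (suc r)) (suc (suc r))  ≡⟨ T-Family.leading-doubles T-degree r ⟩
    + 2 * T (suc r) (suc r)        ≡⟨ cong (+ 2 *_) (T-leading r) ⟩
    + 2 * + (2 ^ r)                ≡⟨ ℤP.pos-* 2 (2 ^ r) ⟨
    + (2 ^ suc r)                  ∎

cheb-leading : ∀ {m} → m ≤ 1 → ∀ n → cheb m (n ℕ.+ m) (n ℕ.+ m) ≡ + (2 ^ n)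
cheb-leading z≤n       n rewrite ℕP.+-identityʳ n = U-leading n
cheb-leading (s≤s z≤n) n rewrite ℕP.+-comm n 1    = T-leading n

-- Axis k = 0 of the recurrence: both sides equal 2^n.
axis-k : ∀ {m} → m ≤ 1 → ∀ n → ChebyshevFamily.Λ (cheb-rec m) m n 0 ≡ R m n 0
axis-k {m} m≤1 n = begin
    + 1 * cheb m (n ℕ.+ 0 ℕ.+ m) (n ℕ.+ 0 ℕ.+ m)  ≡⟨ ℤP.*-identityˡ _ ⟩
    cheb m (n ℕ.+ 0 ℕ.+ m) (n ℕ.+ 0 ℕ.+ m)        ≡⟨ cong (λ t → cheb m (t ℕ.+ m) (t ℕ.+ m)) (ℕP.+-identityʳ n) ⟩
    cheb m (n ℕ.+ m) (n ℕ.+ m)                    ≡⟨ cheb-leading m≤1 n ⟩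
    + (2 ^ n)                                     ≡⟨ H-diag n m ⟨
    H n m n                                       ≡⟨ cong (H n m) (ℕP.+-identityʳ n) ⟨
    R m n 0                                       ∎

-- Axis n = 0: (-1)^k [x^{m-k}] F_{k+m} = C(m,k), from U_0 = 1, T_1 = x, T_2 = 2x² − 1
-- and the vanishing of coefficients at negative exponents.
axis-n : ∀ {m} → m ≤ 1 → ∀ k → ChebyshevFamily.Λ (cheb-rec m) m 0 k ≡ R m 0 k
axis-n z≤n       zero          = refl
axis-n z≤n       (suc k)       = ℤP.*-zeroʳ (sgn (suc k))
axis-n (s≤s z≤n) zero          = refl
axis-n (s≤s z≤n) (suc zero)    = refl
axis-n (s≤s z≤n) (suc (suc k)) = ℤP.*-zeroʳ (sgn (suc (suc k)))

theorem6 : (n k m : ℕ) → 1 ≤ n → m ≤ 1 →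
    sgn k * a m (n ℕ.+ k ℕ.+ m) ((+ n) - (+ k) ℤ.+ (+ m))
      ≡ sumTo n (λ i → sgn i * (+ (n C i)) * (+ ((2 ℕ.* n ℕ.+ m ∸ 2 ℕ.* i) C (n ℕ.+ k))))
theorem6 n k m _ m≤1 =
  recurrence-unique {Λ m} {R m} (Λ-rec m) (R-rec m) (axis-n m≤1) (axis-k m≤1) n k
  where open ChebyshevFamily (cheb-rec m)
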